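{- Let $a, b$ be distinct non-constant polynomials in $\mathbb{F}_2[z]$. Define $M_0(a,b) = \begin{pmatrix} 1 & a \\ a & 0\end{pmatrix}$, $M_0(b,a)=\begin{pmatrix} 1 & b \\ b & 0\end{pmatrix}$, and for $k\ge1$, $M_k(a,b) = M_{k-1}(a,b)\, M_{k-1}(b,a)^2\, M_{k-1}(a,b)$, $M_k(b,a) = M_{k-1}(b,a)\, M_{k-1}(a,b)^2\, M_{k-1}(b,a)$, and write $M_k(a,b) = \begin{pmatrix} Q_k & P_k\\ P_k & R_k\end{pmatrix}$. Let $n_k = 2^{2k-1}$ and set $$a_2 = (1+a+b)^2,\quad a_0 = a(a+b)a_2 + a^2,\quad a_1 = a_3 = (a+b)a_2,\quad a_4 = b(a+b)a_2 + a^2,$$ $$\delta_k = a_4P_k^4 + a_3P_k^3Q_k + a_2P_k^2Q_k^2 + a_1P_kQ_k^3 + a_0Q_k^4.$$ Then for every $k\ge1$ there exists a polynomial $T_k(X,Y)$ with coefficients in $\mathbb{F}_2$ such that $\delta_k = (ab)^{2n_k}\,T_k(a,b)$.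
   Context: All computations take place in $\mathbb{F}_2[z]$ (characteristic $2$). -}

module Defs where

open import Data.Bool using (Bool; true; false; _xor_; if_then_else_)
open import Data.List using (List; []; _∷_; length)
open import Data.Nat using (ℕ; zero; suc; _∸_; _^_; _*_)
open import Relation.Binary.PropositionalEquality using (_≡_)

-- Polynomials in F₂[z]: coefficient lists, lowest degree first.
-- Trailing zero coefficients are allowed; equality is taken up to them (_≈ₚ_).
Poly : Set
Poly = List Bool

0ₚ 1ₚ : Poly
0ₚ = []
1ₚ = true ∷ []

const : Bool → Poly
const c = c ∷ []

infixl 6 _+ₚ_
infixl 7 _*ₚ_

_+ₚ_ : Poly → Poly → Poly
[] +ₚ q = q
(c ∷ p) +ₚ [] = c ∷ p
(c ∷ p) +ₚ (d ∷ q) = (c xor d) ∷ (p +ₚ q)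

_*ₚ_ : Poly → Poly → Poly
[] *ₚ q = []
(c ∷ p) *ₚ q = (if c then q else []) +ₚ (false ∷ (p *ₚ q))

_^ₚ_ : Poly → ℕ → Poly
p ^ₚ zero = 1ₚ
p ^ₚ suc n = p *ₚ (p ^ₚ n)

norm : Poly → Poly
norm [] = []
norm (c ∷ p) with norm p
norm (false ∷ p) | [] = []
norm (true ∷ p) | [] = true ∷ []
norm (c ∷ p) | d ∷ r = c ∷ d ∷ r

infix 4 _≈ₚ_
_≈ₚ_ : Poly → Poly → Set
p ≈ₚ q = norm p ≡ norm q

NonConstant : Poly → Set
NonConstant p = 2 Data.Nat.≤ length (norm p)

record Mat : Set where
  constructor mat
  field
    m11 m12 m21 m22 : Poly
open Mat public

infixl 7 _·_
_·_ : Mat → Mat → Mat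
mat a b c d · mat e f g h =
  mat (a *ₚ e +ₚ b *ₚ g) (a *ₚ f +ₚ b *ₚ h) (c *ₚ e +ₚ d *ₚ g) (c *ₚ f +ₚ d *ₚ h)

M : ℕ → Poly → Poly → Mat
M zero a b = mat 1ₚ a a 0ₚ
M (suc k) a b = M k a b · (M k b a · M k b a) · M k a b

Q P R : ℕ → Poly → Poly → Poly
Q k a b = m11 (M k a b)
P k a b = m12 (M k a b)
R k a b = m22 (M k a b)

nk : ℕ → ℕ
nk k = 2 ^ (2 * k ∸ 1)

coefA2 coefA0 coefA1 coefA3 coefA4 : Poly → Poly → Poly
coefA2 a b = (1ₚ +ₚ a +ₚ b) ^ₚ 2
coefA0 a b = a *ₚ (a +ₚ b) *ₚ coefA2 a b +ₚ a ^ₚ 2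
coefA1 a b = (a +ₚ b) *ₚ coefA2 a b
coefA3 a b = (a +ₚ b) *ₚ coefA2 a b
coefA4 a b = b *ₚ (a +ₚ b) *ₚ coefA2 a b +ₚ a ^ₚ 2

δ : ℕ → Poly → Poly → Poly
δ k a b =
  coefA4 a b *ₚ (Pk ^ₚ 4)
  +ₚ coefA3 a b *ₚ (Pk ^ₚ 3) *ₚ Qk
  +ₚ coefA2 a b *ₚ (Pk ^ₚ 2) *ₚ (Qk ^ₚ 2)
  +ₚ coefA1 a b *ₚ Pk *ₚ (Qk ^ₚ 3)
  +ₚ coefA0 a b *ₚ (Qk ^ₚ 4)
  where
    Pk = P k a b
    Qk = Q k a b

-- Bivariate polynomials T(X,Y) over F₂: list of coefficients in X (lowest first),
-- each coefficient a polynomial in Y over F₂ (list of Bool, lowest first).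
BiPoly : Set
BiPoly = List (List Bool)

evalAt : List Bool → Poly → Poly
evalAt [] y = 0ₚ
evalAt (c ∷ p) y = const c +ₚ y *ₚ evalAt p y

evalBi : BiPoly → Poly → Poly → Poly
evalBi [] x y = 0ₚ
evalBi (t ∷ T) x y = evalAt t y +ₚ x *ₚ evalBi T x y

module Submission where

-- Parametrise M_{j+1}(a,b) and M_{j+1}(b,a) by three polynomials (r, p, ρ): with s = a + b and
-- c = 1 + a + b they are [[r + c²ρ, p], [p, r]] and [[r + ρ, p + sρ], [p + sρ, r + s²ρ]].
-- The recursion preserves this shape and acts on (r, p, ρ) by an explicit polynomial map. Under it
-- the common determinant det = p² + r(r + c²ρ) is raised to the fourth power, so det M_k = (ab)^(4^k),
-- and the quantity Λ, which vanishes for k = 1, is multiplied by c⁸ρ⁶, so it vanishes for every k.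
-- Finally δ_k, a binary quartic form in (Q_k, P_k), equals det · T + Q_k² c⁴ Λ for a cofactor T that
-- is a polynomial over F₂ in a, b, r, p, ρ; and r, p, ρ are themselves polynomials over F₂ in a and b.

open import Defs
open import Algebra.Bundles using (CommutativeRing; CommutativeSemigroup; RawRing)
import Algebra.Properties.CommutativeSemigroup as CommutativeSemigroupProperties
import Algebra.Solver.Ring as RingSolver
open import Algebra.Solver.Ring.AlmostCommutativeRing
  using (_-Raw-AlmostCommutative⟶_; fromCommutativeRing)
open import Data.Bool using (Bool; true; false; _xor_; _∧_; if_then_else_)
import Data.Bool.Properties as Bool
open import Data.Bool.Properties
  using (xor-∧-commutativeRing; xor-comm; xor-assoc; xor-same; xor-identityˡ; xor-identityʳ)
open import Data.Fin using (#_)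
open import Data.List using (List; []; _∷_; map)
open import Data.Maybe using (Maybe; just; nothing)
open import Data.Nat using (ℕ; zero; suc; _≤_; s≤s; z≤n)
open import Data.Product using (Σ; ∃; _,_; _×_; proj₁; proj₂)
open import Data.Vec using (Vec; _∷_; [])
open import Level using (0ℓ)
open import Relation.Nullary using (¬_; yes; no)
open import Relation.Binary.Structures using (IsEquivalence)
import Relation.Binary.Reasoning.Setoid as SetoidReasoning
open import Relation.Binary.PropositionalEquality
  using (_≡_; refl; sym; trans; cong; cong₂; subst; module ≡-Reasoning)

coeff : Poly → ℕ → Bool
coeff []      _       = false
coeff (c ∷ p) zero    = c
coeff (c ∷ p) (suc n) = coeff p n

infix 4 _≋_
record _≋_ (p q : Poly) : Set where
  constructor coeffwise
  field coeff-≡ : ∀ n → coeff p n ≡ coeff q n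
open _≋_

≋-refl : ∀ {p} → p ≋ p
≋-refl = coeffwise λ _ → refl

≋-sym : ∀ {p q} → p ≋ q → q ≋ p
≋-sym e = coeffwise λ n → sym (coeff-≡ e n)

≋-trans : ∀ {p q r} → p ≋ q → q ≋ r → p ≋ r
≋-trans e f = coeffwise λ n → trans (coeff-≡ e n) (coeff-≡ f n)

≋-reflexive : ∀ {p q} → p ≡ q → p ≋ q
≋-reflexive refl = ≋-refl

≋-isEquivalence : IsEquivalence _≋_
≋-isEquivalence = record { refl = ≋-refl ; sym = ≋-sym ; trans = ≋-trans }

∷-cong : ∀ {c p q} → p ≋ q → c ∷ p ≋ c ∷ q
∷-cong e = coeffwise λ { zero → refl ; (suc n) → coeff-≡ e n }

false∷≋[] : ∀ {p} → p ≋ [] → false ∷ p ≋ []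
false∷≋[] e = coeffwise λ { zero → refl ; (suc n) → coeff-≡ e n }

normCons : Bool → Poly → Poly
normCons false []      = []
normCons true  []      = true ∷ []
normCons c     (d ∷ p) = c ∷ d ∷ p

norm-∷ : ∀ c p → norm (c ∷ p) ≡ normCons c (norm p)
norm-∷ c p with norm p
norm-∷ false p | []    = refl
norm-∷ true  p | []    = refl
norm-∷ false p | d ∷ q = refl
norm-∷ true  p | d ∷ q = refl

norm-≋[] : ∀ {p} → p ≋ [] → norm p ≡ []
norm-≋[] {[]}    e = refl
norm-≋[] {c ∷ p} e with coeff-≡ e 0
... | refl =
  trans (norm-∷ false p) (cong (normCons false) (norm-≋[] {p} (coeffwise λ n → coeff-≡ e (suc n))))

≋⇒≈ₚ : ∀ {p q} → p ≋ q → p ≈ₚ q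
≋⇒≈ₚ {[]}    {q}     e = sym (norm-≋[] (≋-sym e))
≋⇒≈ₚ {c ∷ p} {[]}    e = norm-≋[] e
≋⇒≈ₚ {c ∷ p} {d ∷ q} e = begin
  norm (c ∷ p)          ≡⟨ norm-∷ c p ⟩
  normCons c (norm p)   ≡⟨ cong₂ normCons (coeff-≡ e 0) (≋⇒≈ₚ {p} {q} tail-≋) ⟩
  normCons d (norm q)   ≡⟨ norm-∷ d q ⟨
  norm (d ∷ q)          ∎
  where
  open ≡-Reasoning
  tail-≋ : p ≋ q
  tail-≋ = coeffwise λ n → coeff-≡ e (suc n)

coeff-+ : ∀ p q n → coeff (p +ₚ q) n ≡ coeff p n xor coeff q n
coeff-+ []      q       n       = sym (xor-identityˡ _)
coeff-+ (c ∷ p) []      n       = sym (xor-identityʳ _)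
coeff-+ (c ∷ p) (d ∷ q) zero    = refl
coeff-+ (c ∷ p) (d ∷ q) (suc n) = coeff-+ p q n

module _ where
  open ≡-Reasoning

  +-cong : ∀ {p p′ q q′} → p ≋ p′ → q ≋ q′ → p +ₚ q ≋ p′ +ₚ q′
  +-cong {p} {p′} {q} {q′} e f = coeffwise λ n → begin
    coeff (p +ₚ q) n            ≡⟨ coeff-+ p q n ⟩
    coeff p n xor coeff q n     ≡⟨ cong₂ _xor_ (coeff-≡ e n) (coeff-≡ f n) ⟩
    coeff p′ n xor coeff q′ n   ≡⟨ coeff-+ p′ q′ n ⟨
    coeff (p′ +ₚ q′) n          ∎

  +-comm : ∀ p q → p +ₚ q ≋ q +ₚ p
  +-comm p q = coeffwise λ n → begin
    coeff (p +ₚ q) n          ≡⟨ coeff-+ p q n ⟩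
    coeff p n xor coeff q n   ≡⟨ xor-comm (coeff p n) (coeff q n) ⟩
    coeff q n xor coeff p n   ≡⟨ coeff-+ q p n ⟨
    coeff (q +ₚ p) n          ∎

  +-assoc : ∀ p q r → (p +ₚ q) +ₚ r ≋ p +ₚ (q +ₚ r)
  +-assoc p q r = coeffwise λ n → begin
    coeff ((p +ₚ q) +ₚ r) n                   ≡⟨ coeff-+ (p +ₚ q) r n ⟩
    coeff (p +ₚ q) n xor coeff r n            ≡⟨ cong (_xor coeff r n) (coeff-+ p q n) ⟩
    (coeff p n xor coeff q n) xor coeff r n   ≡⟨ xor-assoc (coeff p n) _ _ ⟩
    coeff p n xor (coeff q n xor coeff r n)   ≡⟨ cong (coeff p n xor_) (coeff-+ q r n) ⟨
    coeff p n xor coeff (q +ₚ r) n            ≡⟨ coeff-+ p (q +ₚ r) n ⟨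
    coeff (p +ₚ (q +ₚ r)) n                   ∎

  +-identityʳ : ∀ p → p +ₚ [] ≋ p
  +-identityʳ p = coeffwise λ n → trans (coeff-+ p [] n) (xor-identityʳ _)

  +-self : ∀ p → p +ₚ p ≋ []
  +-self p = coeffwise λ n → trans (coeff-+ p p n) (xor-same (coeff p n))

+-commutativeSemigroup : CommutativeSemigroup 0ℓ 0ℓ
+-commutativeSemigroup = record
  { Carrier = Poly ; _≈_ = _≋_ ; _∙_ = _+ₚ_
  ; isCommutativeSemigroup = record
    { isSemigroup = record
      { isMagma = record { isEquivalence = ≋-isEquivalence ; ∙-cong = +-cong }
      ; assoc = +-assoc }
    ; comm = +-comm } }

open CommutativeSemigroupProperties +-commutativeSemigroup
  using () renaming (interchange to +-interchange; x∙yz≈y∙xz to +-exchange)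

scale : Bool → Poly → Poly
scale c q = if c then q else []

scale-xor : ∀ c d r → scale (c xor d) r ≋ scale c r +ₚ scale d r
scale-xor false d     r = ≋-refl
scale-xor true  false r = ≋-sym (+-identityʳ r)
scale-xor true  true  r = ≋-sym (+-self r)

scale-* : ∀ c q r → scale c q *ₚ r ≡ scale c (q *ₚ r)
scale-* false q r = refl
scale-* true  q r = refl

*-congˡ : ∀ p {q q′} → q ≋ q′ → p *ₚ q ≋ p *ₚ q′
*-congˡ []          e = ≋-refl
*-congˡ (false ∷ p) e = ∷-cong (*-congˡ p e)
*-congˡ (true ∷ p)  e = +-cong e (∷-cong (*-congˡ p e))

*-zeroʳ : ∀ p → p *ₚ [] ≋ []
*-zeroʳ []          = ≋-refl
*-zeroʳ (false ∷ p) = false∷≋[] (*-zeroʳ p)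
*-zeroʳ (true ∷ p)  = false∷≋[] (*-zeroʳ p)

*-∷ : ∀ p c q → p *ₚ (c ∷ q) ≋ scale c p +ₚ (false ∷ p *ₚ q)
*-∷ []      false q = ≋-sym (false∷≋[] ≋-refl)
*-∷ []      true  q = ≋-sym (false∷≋[] ≋-refl)
*-∷ (d ∷ p) c     q = ≋-trans (+-cong ≋-refl (∷-cong (*-∷ p c q))) (exchange-heads d c)
  where
  exchange-heads : ∀ d c → scale d (c ∷ q) +ₚ (false ∷ scale c p +ₚ (false ∷ p *ₚ q))
                         ≋ scale c (d ∷ p) +ₚ (false ∷ scale d q +ₚ (false ∷ p *ₚ q))
  exchange-heads false false = ≋-refl
  exchange-heads false true  = ≋-refl
  exchange-heads true  false = ≋-refl
  exchange-heads true  true  = ∷-cong (+-exchange q p (false ∷ p *ₚ q))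

*-comm : ∀ p q → p *ₚ q ≋ q *ₚ p
*-comm []      q = ≋-sym (*-zeroʳ q)
*-comm (c ∷ p) q = ≋-trans (+-cong ≋-refl (∷-cong (*-comm p q))) (≋-sym (*-∷ q c p))

*-congʳ : ∀ {p p′} q → p ≋ p′ → p *ₚ q ≋ p′ *ₚ q
*-congʳ {p} {p′} q e = ≋-trans (*-comm p q) (≋-trans (*-congˡ q e) (*-comm q p′))

*-cong : ∀ {p p′ q q′} → p ≋ p′ → q ≋ q′ → p *ₚ q ≋ p′ *ₚ q′
*-cong {p′ = p′} {q} e f = ≋-trans (*-congʳ q e) (*-congˡ p′ f)

*-distribʳ : ∀ r p q → (p +ₚ q) *ₚ r ≋ p *ₚ r +ₚ q *ₚ r
*-distribʳ r []      q       = ≋-refl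
*-distribʳ r (c ∷ p) []      = ≋-sym (+-identityʳ _)
*-distribʳ r (c ∷ p) (d ∷ q) =
  ≋-trans (+-cong (scale-xor c d r) (∷-cong (*-distribʳ r p q)))
          (+-interchange (scale c r) (scale d r) (false ∷ p *ₚ r) (false ∷ q *ₚ r))

*-distribˡ : ∀ p q r → p *ₚ (q +ₚ r) ≋ p *ₚ q +ₚ p *ₚ r
*-distribˡ p q r =
  ≋-trans (*-comm p (q +ₚ r)) (≋-trans (*-distribʳ p q r) (+-cong (*-comm q p) (*-comm r p)))

*-assoc : ∀ p q r → (p *ₚ q) *ₚ r ≋ p *ₚ (q *ₚ r)
*-assoc []      q r = ≋-refl
*-assoc (c ∷ p) q r =
  ≋-trans (*-distribʳ r (scale c q) (false ∷ p *ₚ q))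
          (+-cong (≋-reflexive (scale-* c q r)) (∷-cong (*-assoc p q r)))

*-identityˡ : ∀ p → 1ₚ *ₚ p ≋ p
*-identityˡ p = ≋-trans (+-cong ≋-refl (false∷≋[] ≋-refl)) (+-identityʳ p)

F₂[z] : CommutativeRing 0ℓ 0ℓ
F₂[z] = record
  { Carrier = Poly ; _≈_ = _≋_ ; _+_ = _+ₚ_ ; _*_ = _*ₚ_ ; -_ = λ p → p ; 0# = [] ; 1# = 1ₚ
  ; isCommutativeRing = record
    { isRing = record
      { +-isAbelianGroup = record
        { isGroup = record
          { isMonoid = record
            { isSemigroup = CommutativeSemigroup.isSemigroup +-commutativeSemigroup
            ; identity    = (λ _ → ≋-refl) , +-identityʳ }
          ; inverse = +-self , +-self
          ; ⁻¹-cong = λ e → e }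
        ; comm = +-comm }
      ; *-cong     = *-cong
      ; *-assoc    = *-assoc
      ; *-identity = *-identityˡ , (λ p → ≋-trans (*-comm p 1ₚ) (*-identityˡ p))
      ; distrib    = *-distribˡ , *-distribʳ }
    ; *-comm = *-comm } }

F₂[z]ʳ : RawRing 0ℓ 0ℓ
F₂[z]ʳ = CommutativeRing.rawRing F₂[z]

F₂ : RawRing 0ℓ 0ℓ
F₂ = CommutativeRing.rawRing xor-∧-commutativeRing

-- Unlike Defs.const, cst false is [], so that the solver's constants evaluate to 0ₚ and 1ₚ on the nose.
cst : Bool → Poly
cst false = []
cst true  = 1ₚ

const≋cst : ∀ c → const c ≋ cst c
const≋cst false = false∷≋[] ≋-refl
const≋cst true  = ≋-refl

cst-homomorphism : F₂ -Raw-AlmostCommutative⟶ fromCommutativeRing F₂[z]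
cst-homomorphism = record
  { ⟦_⟧    = cst
  ; +-homo = +-homo
  ; *-homo = *-homo
  ; -‿homo = λ _ → ≋-refl
  ; 0-homo = ≋-refl
  ; 1-homo = ≋-refl
  }
  where
  +-homo : ∀ x y → cst (x xor y) ≋ cst x +ₚ cst y
  +-homo false y     = ≋-refl
  +-homo true  false = ≋-refl
  +-homo true  true  = ≋-sym (false∷≋[] ≋-refl)

  *-homo : ∀ x y → cst (x ∧ y) ≋ cst x *ₚ cst y
  *-homo false y     = ≋-refl
  *-homo true  false = ≋-sym (false∷≋[] ≋-refl)
  *-homo true  true  = ≋-refl

cst-≟ : ∀ x y → Maybe (cst x ≋ cst y)
cst-≟ x y with x Bool.≟ y
... | yes refl = just ≋-refl
... | no _     = nothing

open RingSolver F₂ (fromCommutativeRing F₂[z]) cst-homomorphism cst-≟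
  using (Polynomial; var; con; _:+_; _:*_; _:^_; :-_; ⟦_⟧; ⟦_⟧↓; prove; solve; _:=_)

Expr : ℕ → RawRing 0ℓ 0ℓ
Expr n = record
  { Carrier = Polynomial n ; _≈_ = _≡_ ; _+_ = _:+_ ; _*_ = _:*_ ; -_ = :-_
  ; 0# = con false ; 1# = con true }

record Mat₂ (A : Set) : Set where
  constructor mat₂
  field e₁₁ e₁₂ e₂₁ e₂₂ : A

mapMat₂ : ∀ {A B : Set} → (A → B) → Mat₂ A → Mat₂ B
mapMat₂ f (mat₂ x₁₁ x₁₂ x₂₁ x₂₂) = mat₂ (f x₁₁) (f x₁₂) (f x₂₁) (f x₂₂)

toMat : Mat₂ Poly → Mat
toMat (mat₂ x₁₁ x₁₂ x₂₁ x₂₂) = mat x₁₁ x₁₂ x₂₁ x₂₂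

infix 4 _≈M_
_≈M_ : Mat → Mat → Set
X ≈M Y = m11 X ≋ m11 Y × m12 X ≋ m12 Y × m21 X ≋ m21 Y × m22 X ≋ m22 Y

≈M-trans : ∀ {X Y Z} → X ≈M Y → Y ≈M Z → X ≈M Z
≈M-trans (e₁₁ , e₁₂ , e₂₁ , e₂₂) (f₁₁ , f₁₂ , f₂₁ , f₂₂) =
  ≋-trans e₁₁ f₁₁ , ≋-trans e₁₂ f₁₂ , ≋-trans e₂₁ f₂₁ , ≋-trans e₂₂ f₂₂

·-cong : ∀ {X X′ Y Y′} → X ≈M X′ → Y ≈M Y′ → X · Y ≈M X′ · Y′
·-cong (e₁₁ , e₁₂ , e₂₁ , e₂₂) (f₁₁ , f₁₂ , f₂₁ , f₂₂) =
  +-cong (*-cong e₁₁ f₁₁) (*-cong e₁₂ f₂₁) , +-cong (*-cong e₁₁ f₁₂) (*-cong e₁₂ f₂₂) ,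
  +-cong (*-cong e₂₁ f₁₁) (*-cong e₂₂ f₂₁) , +-cong (*-cong e₂₁ f₁₂) (*-cong e₂₂ f₂₂)

-- Stated over an arbitrary raw ring, so that one text serves F₂[z], the solver's expressions (whose
-- evaluation is definitionally the F₂[z] instance) and the subring F₂[ a , b ]ʳ below.
module Formulas (R : RawRing 0ℓ 0ℓ) (a b : RawRing.Carrier R) where
  open RawRing R
  open import Algebra.Definitions.RawSemiring rawSemiring using (_^_)

  infixl 7 _⊙_
  _⊙_ : Mat₂ Carrier → Mat₂ Carrier → Mat₂ Carrier
  mat₂ x₁₁ x₁₂ x₂₁ x₂₂ ⊙ mat₂ y₁₁ y₁₂ y₂₁ y₂₂ =
    mat₂ (x₁₁ * y₁₁ + x₁₂ * y₂₁) (x₁₁ * y₁₂ + x₁₂ * y₂₂)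
         (x₂₁ * y₁₁ + x₂₂ * y₂₁) (x₂₁ * y₁₂ + x₂₂ * y₂₂)

  recurrence : Mat₂ Carrier → Mat₂ Carrier → Mat₂ Carrier
  recurrence X Y = X ⊙ (Y ⊙ Y) ⊙ X

  M₀ : Carrier → Mat₂ Carrier
  M₀ x = mat₂ 1# x x 0#

  s c A₀ A₁ A₂ A₄ : Carrier
  s  = a + b
  c  = 1# + a + b
  A₂ = c ^ 2
  A₀ = a * s * A₂ + a ^ 2
  A₁ = s * A₂
  A₄ = b * s * A₂ + a ^ 2

  δ-form : Carrier → Carrier → Carrier
  δ-form Q P = A₄ * P ^ 4 + A₁ * P ^ 3 * Q + A₂ * P ^ 2 * Q ^ 2 + A₁ * P * Q ^ 3 + A₀ * Q ^ 4

  record Params : Set where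
    constructor params
    field r p ρ : Carrier
  open Params public

  q : Params → Carrier
  q t = r t + A₂ * ρ t

  shapeAB shapeBA : Params → Mat₂ Carrier
  shapeAB t = mat₂ (q t) (p t) (p t) (r t)
  shapeBA t = mat₂ (r t + ρ t) (p t + s * ρ t) (p t + s * ρ t) (r t + s ^ 2 * ρ t)

  det Λ δ-cofactor : Params → Carrier
  det t        = p t ^ 2 + r t * q t
  Λ t          = p t ^ 2 + s * ρ t * p t + s ^ 2 * ρ t * q t + A₄ * ρ t ^ 2
  δ-cofactor t = A₄ * (q t * r t + p t ^ 2) + A₁ * q t * p t + s ^ 2 * A₂ * q t ^ 2

  params₁ : Params
  params₁ = params (a ^ 2 + a ^ 2 * b ^ 2) (a + a * b ^ 2 + a ^ 2 * b) 1#

  next : Params → Params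
  next t = params (A₂ * ρ t ^ 2 * (p t + r t) ^ 2 + det t ^ 2)
                  (A₂ * ρ t ^ 2 * (A₂ * ρ t * p t + s * det t))
                  (c ^ 4 * ρ t ^ 4)

  paramsAt : ℕ → Params
  paramsAt zero    = params₁
  paramsAt (suc j) = next (paramsAt j)

module Identities (a b : Poly) where
  open Formulas F₂[z]ʳ a b
  private
    module S₂ = Formulas (Expr 2) (var (# 0)) (var (# 1))
    module S  = Formulas (Expr 5) (var (# 0)) (var (# 1))

    tₛ : S.Params
    tₛ = S.params (var (# 2)) (var (# 3)) (var (# 4))

    ⟨_⟩ : Params → Vec Poly 5
    ⟨ t ⟩ = a ∷ b ∷ r t ∷ p t ∷ ρ t ∷ []

    ⟦_⟧ₘ : ∀ {n} → Mat₂ (Polynomial n) → Vec Poly n → Mat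
    ⟦ X ⟧ₘ env = toMat (mapMat₂ (λ e → ⟦ e ⟧ env) X)

    proveₘ : ∀ {n} (env : Vec Poly n) (X Y : Mat₂ (Polynomial n)) → let open Mat₂ in
      ⟦ e₁₁ X ⟧↓ env ≋ ⟦ e₁₁ Y ⟧↓ env → ⟦ e₁₂ X ⟧↓ env ≋ ⟦ e₁₂ Y ⟧↓ env →
      ⟦ e₂₁ X ⟧↓ env ≋ ⟦ e₂₁ Y ⟧↓ env → ⟦ e₂₂ X ⟧↓ env ≋ ⟦ e₂₂ Y ⟧↓ env →
      ⟦ X ⟧ₘ env ≈M ⟦ Y ⟧ₘ env
    proveₘ env X Y h₁₁ h₁₂ h₂₁ h₂₂ = let open Mat₂ in
      prove env (e₁₁ X) (e₁₁ Y) h₁₁ , prove env (e₁₂ X) (e₁₂ Y) h₁₂ ,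
      prove env (e₂₁ X) (e₂₁ Y) h₂₁ , prove env (e₂₂ X) (e₂₂ Y) h₂₂

  M₁-shapeAB : M 1 a b ≈M toMat (shapeAB params₁)
  M₁-shapeAB = proveₘ (a ∷ b ∷ []) (S₂.recurrence (S₂.M₀ (var (# 0))) (S₂.M₀ (var (# 1))))
                      (S₂.shapeAB S₂.params₁) ≋-refl ≋-refl ≋-refl ≋-refl

  M₁-shapeBA : M 1 b a ≈M toMat (shapeBA params₁)
  M₁-shapeBA = proveₘ (a ∷ b ∷ []) (S₂.recurrence (S₂.M₀ (var (# 1))) (S₂.M₀ (var (# 0))))
                      (S₂.shapeBA S₂.params₁) ≋-refl ≋-refl ≋-refl ≋-refl

  recurrence-shapeAB : ∀ t → toMat (recurrence (shapeAB t) (shapeBA t)) ≈M toMat (shapeAB (next t))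
  recurrence-shapeAB t = proveₘ ⟨ t ⟩ (S.recurrence (S.shapeAB tₛ) (S.shapeBA tₛ))
                                (S.shapeAB (S.next tₛ)) ≋-refl ≋-refl ≋-refl ≋-refl

  recurrence-shapeBA : ∀ t → toMat (recurrence (shapeBA t) (shapeAB t)) ≈M toMat (shapeBA (next t))
  recurrence-shapeBA t = proveₘ ⟨ t ⟩ (S.recurrence (S.shapeBA tₛ) (S.shapeAB tₛ))
                                (S.shapeBA (S.next tₛ)) ≋-refl ≋-refl ≋-refl ≋-refl

  det-params₁ : det params₁ ≋ (a *ₚ b) ^ₚ 4
  det-params₁ = prove (a ∷ b ∷ []) (S₂.det S₂.params₁) ((var (# 0) :* var (# 1)) :^ 4) ≋-refl

  det-next : ∀ t → det (next t) ≋ det t ^ₚ 4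
  det-next t = prove ⟨ t ⟩ (S.det (S.next tₛ)) (S.det tₛ :^ 4) ≋-refl

  Λ-params₁ : Λ params₁ ≋ []
  Λ-params₁ = prove (a ∷ b ∷ []) (S₂.Λ S₂.params₁) (con false) ≋-refl

  Λ-next : ∀ t → Λ (next t) ≋ c ^ₚ 8 *ₚ ρ t ^ₚ 6 *ₚ Λ t
  Λ-next t = prove ⟨ t ⟩ (S.Λ (S.next tₛ)) (S.c :^ 8 :* var (# 4) :^ 6 :* S.Λ tₛ) ≋-refl

  δ-form-factorisation : ∀ t →
    δ-form (q t) (p t) ≋ det t *ₚ δ-cofactor t +ₚ q t ^ₚ 2 *ₚ c ^ₚ 4 *ₚ Λ t
  δ-form-factorisation t =
    prove ⟨ t ⟩ (S.δ-form (S.q tₛ) (S.p tₛ))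
                (S.det tₛ :* S.δ-cofactor tₛ :+ S.q tₛ :^ 2 :* S.c :^ 4 :* S.Λ tₛ) ≋-refl

-- Imported only here: inside Formulas they would clash with the ring's _*_ and _^_.
open import Data.Nat using (_*_; _^_)
import Data.Nat.Properties as ℕ
open import Algebra.Properties.Semiring.Exp (CommutativeRing.semiring F₂[z])
  using (^-congˡ; ^-assocʳ) renaming (_^_ to _^ᵉ_)

^ₚ≡^ᵉ : ∀ x n → x ^ₚ n ≡ x ^ᵉ n
^ₚ≡^ᵉ x zero    = refl
^ₚ≡^ᵉ x (suc n) = cong (x *ₚ_) (^ₚ≡^ᵉ x n)

^ₚ-assocʳ : ∀ x m n → (x ^ₚ m) ^ₚ n ≋ x ^ₚ (m * n)
^ₚ-assocʳ x m n rewrite ^ₚ≡^ᵉ (x ^ₚ m) n | ^ₚ≡^ᵉ x m | ^ₚ≡^ᵉ x (m * n) = ^-assocʳ x m n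

module Recursion (a b : Poly) where
  open Formulas F₂[z]ʳ a b
  open Identities a b

  M-shape : ∀ j → M (suc j) a b ≈M toMat (shapeAB (paramsAt j))
                × M (suc j) b a ≈M toMat (shapeBA (paramsAt j))
  M-shape zero = M₁-shapeAB , M₁-shapeBA
  M-shape (suc j) with M-shape j
  ... | A , B = ≈M-trans (·-cong (·-cong A (·-cong B B)) A) (recurrence-shapeAB (paramsAt j)) ,
                ≈M-trans (·-cong (·-cong B (·-cong A A)) B) (recurrence-shapeBA (paramsAt j))

  Λ-paramsAt : ∀ j → Λ (paramsAt j) ≋ []
  Λ-paramsAt zero    = Λ-params₁
  Λ-paramsAt (suc j) = ≋-trans (Λ-next (paramsAt j))
    (≋-trans (*-congˡ factor (Λ-paramsAt j)) (*-zeroʳ factor))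
    where
    factor : Poly
    factor = c ^ₚ 8 *ₚ ρ (paramsAt j) ^ₚ 6

  det-paramsAt : ∀ j → det (paramsAt j) ≋ (a *ₚ b) ^ₚ (4 ^ suc j)
  det-paramsAt zero    = det-params₁
  det-paramsAt (suc j) = begin
    det (next (paramsAt j))              ≈⟨ det-next (paramsAt j) ⟩
    det (paramsAt j) ^ₚ 4                ≈⟨ ^-congˡ 4 (det-paramsAt j) ⟩
    ((a *ₚ b) ^ₚ (4 ^ suc j)) ^ₚ 4       ≈⟨ ^ₚ-assocʳ (a *ₚ b) (4 ^ suc j) 4 ⟩
    (a *ₚ b) ^ₚ (4 ^ suc j * 4)          ≡⟨ cong ((a *ₚ b) ^ₚ_) (ℕ.*-comm (4 ^ suc j) 4) ⟩
    (a *ₚ b) ^ₚ (4 ^ suc (suc j))        ∎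
    where open SetoidReasoning (CommutativeRing.setoid F₂[z])

  δ-form-cong : ∀ {Q Q′ P P′} → Q ≋ Q′ → P ≋ P′ → δ-form Q P ≋ δ-form Q′ P′
  δ-form-cong eQ eP =
    +-cong (+-cong (+-cong (+-cong
      (*-congˡ A₄ (^-congˡ 4 eP))
      (*-cong (*-congˡ A₁ (^-congˡ 3 eP)) eQ))
      (*-cong (*-congˡ A₂ (^-congˡ 2 eP)) (^-congˡ 2 eQ)))
      (*-cong (*-congˡ A₁ eP) (^-congˡ 3 eQ)))
      (*-congˡ A₀ (^-congˡ 4 eQ))

  δ-factorisation : ∀ j → δ (suc j) a b ≋ (a *ₚ b) ^ₚ (4 ^ suc j) *ₚ δ-cofactor (paramsAt j)
  δ-factorisation j with M-shape j
  ... | (Q≋q , P≋p , _) , _ = begin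
    δ (suc j) a b                                  ≈⟨ δ-form-cong Q≋q P≋p ⟩
    δ-form (q t) (p t)                             ≈⟨ δ-form-factorisation t ⟩
    det t *ₚ δ-cofactor t +ₚ factor *ₚ Λ t         ≈⟨ +-cong ≋-refl (*-congˡ factor (Λ-paramsAt j)) ⟩
    det t *ₚ δ-cofactor t +ₚ factor *ₚ []          ≈⟨ +-cong ≋-refl (*-zeroʳ factor) ⟩
    det t *ₚ δ-cofactor t +ₚ []                    ≈⟨ +-identityʳ _ ⟩
    det t *ₚ δ-cofactor t                          ≈⟨ *-congʳ (δ-cofactor t) (det-paramsAt j) ⟩
    (a *ₚ b) ^ₚ (4 ^ suc j) *ₚ δ-cofactor t        ∎
    where
    open SetoidReasoning (CommutativeRing.setoid F₂[z])
    t : Params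
    t = paramsAt j
    factor : Poly
    factor = q t ^ₚ 2 *ₚ c ^ₚ 4

infixl 6 _+ᴮ_
infixl 7 _*ᴮ_ _·ᴮ_

_+ᴮ_ : BiPoly → BiPoly → BiPoly
[]      +ᴮ T       = T
(s ∷ S) +ᴮ []      = s ∷ S
(s ∷ S) +ᴮ (t ∷ T) = s +ₚ t ∷ S +ᴮ T

_·ᴮ_ : Poly → BiPoly → BiPoly
t ·ᴮ S = map (t *ₚ_) S

_*ᴮ_ : BiPoly → BiPoly → BiPoly
[]      *ᴮ T = []
(s ∷ S) *ᴮ T = s ·ᴮ T +ᴮ ([] ∷ S *ᴮ T)

horner-+ : ∀ c d y u v → (c +ₚ d) +ₚ y *ₚ (u +ₚ v) ≋ (c +ₚ y *ₚ u) +ₚ (d +ₚ y *ₚ v)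
horner-+ = solve 5 (λ c d y u v → (c :+ d) :+ y :* (u :+ v) := (c :+ y :* u) :+ (d :+ y :* v)) ≋-refl

horner-* : ∀ c y u v → c *ₚ v +ₚ y *ₚ (u *ₚ v) ≋ (c +ₚ y *ₚ u) *ₚ v
horner-* = solve 4 (λ c y u v → c :* v :+ y :* (u :* v) := (c :+ y :* u) :* v) ≋-refl

horner-· : ∀ c y u v → c *ₚ u +ₚ y *ₚ (c *ₚ v) ≋ c *ₚ (u +ₚ y *ₚ v)
horner-· = solve 4 (λ c y u v → c :* u :+ y :* (c :* v) := c :* (u :+ y :* v)) ≋-refl

evalAt-+ : ∀ f g y → evalAt (f +ₚ g) y ≋ evalAt f y +ₚ evalAt g y
evalAt-+ []      g       y = ≋-refl
evalAt-+ (c ∷ f) []      y = ≋-sym (+-identityʳ _)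
evalAt-+ (c ∷ f) (d ∷ g) y =
  ≋-trans (+-cong ≋-refl (*-congˡ y (evalAt-+ f g y)))
          (horner-+ (const c) (const d) y (evalAt f y) (evalAt g y))

evalAt-scale : ∀ c g y → evalAt (scale c g) y ≋ const c *ₚ evalAt g y
evalAt-scale false g y = ≋-sym (false∷≋[] ≋-refl)
evalAt-scale true  g y = ≋-sym (*-identityˡ _)

evalAt-* : ∀ f g y → evalAt (f *ₚ g) y ≋ evalAt f y *ₚ evalAt g y
evalAt-* []      g y = ≋-refl
evalAt-* (c ∷ f) g y = begin
  evalAt (scale c g +ₚ (false ∷ f *ₚ g)) y
    ≈⟨ evalAt-+ (scale c g) (false ∷ f *ₚ g) y ⟩
  evalAt (scale c g) y +ₚ (const false +ₚ y *ₚ evalAt (f *ₚ g) y)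
    ≈⟨ +-cong (evalAt-scale c g y) (+-cong (const≋cst false) (*-congˡ y (evalAt-* f g y))) ⟩
  const c *ₚ evalAt g y +ₚ y *ₚ (evalAt f y *ₚ evalAt g y)
    ≈⟨ horner-* (const c) y (evalAt f y) (evalAt g y) ⟩
  (const c +ₚ y *ₚ evalAt f y) *ₚ evalAt g y
    ∎
  where open SetoidReasoning (CommutativeRing.setoid F₂[z])

module _ (a b : Poly) where

  evalBi-+ : ∀ S T → evalBi (S +ᴮ T) a b ≋ evalBi S a b +ₚ evalBi T a b
  evalBi-+ []      T       = ≋-refl
  evalBi-+ (s ∷ S) []      = ≋-sym (+-identityʳ _)
  evalBi-+ (s ∷ S) (t ∷ T) =
    ≋-trans (+-cong (evalAt-+ s t b) (*-congˡ a (evalBi-+ S T)))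
            (horner-+ (evalAt s b) (evalAt t b) a (evalBi S a b) (evalBi T a b))

  evalBi-· : ∀ t S → evalBi (t ·ᴮ S) a b ≋ evalAt t b *ₚ evalBi S a b
  evalBi-· t []      = ≋-sym (*-zeroʳ (evalAt t b))
  evalBi-· t (s ∷ S) =
    ≋-trans (+-cong (evalAt-* t s b) (*-congˡ a (evalBi-· t S)))
            (horner-· (evalAt t b) a (evalAt s b) (evalBi S a b))

  evalBi-* : ∀ S T → evalBi (S *ᴮ T) a b ≋ evalBi S a b *ₚ evalBi T a b
  evalBi-* []      T = ≋-refl
  evalBi-* (s ∷ S) T =
    ≋-trans (evalBi-+ (s ·ᴮ T) ([] ∷ S *ᴮ T))
    (≋-trans (+-cong (evalBi-· s T) (*-congˡ a (evalBi-* S T)))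
             (horner-* (evalAt s b) a (evalBi S a b) (evalBi T a b)))

infix 4 _∈F₂[_,_]
_∈F₂[_,_] : Poly → Poly → Poly → Set
f ∈F₂[ a , b ] = ∃ λ T → f ≋ evalBi T a b

module _ {a b : Poly} where

  +-∈ : ∀ {f g} → f ∈F₂[ a , b ] → g ∈F₂[ a , b ] → f +ₚ g ∈F₂[ a , b ]
  +-∈ (S , f≋S) (T , g≋T) = S +ᴮ T , ≋-trans (+-cong f≋S g≋T) (≋-sym (evalBi-+ a b S T))

  *-∈ : ∀ {f g} → f ∈F₂[ a , b ] → g ∈F₂[ a , b ] → f *ₚ g ∈F₂[ a , b ]
  *-∈ (S , f≋S) (T , g≋T) = S *ᴮ T , ≋-trans (*-cong f≋S g≋T) (≋-sym (evalBi-* a b S T))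

  0-∈ : [] ∈F₂[ a , b ]
  0-∈ = [] , ≋-refl

  1-∈ : 1ₚ ∈F₂[ a , b ]
  1-∈ = 1ₚ ∷ [] ,
    solve 2 (λ a b → con true := (con true :+ b :* con false) :+ a :* con false) ≋-refl a b

  a-∈ : a ∈F₂[ a , b ]
  a-∈ = [] ∷ 1ₚ ∷ [] ,
    solve 2 (λ a b → a := a :* ((con true :+ b :* con false) :+ a :* con false)) ≋-refl a b

  b-∈ : b ∈F₂[ a , b ]
  b-∈ = (false ∷ true ∷ []) ∷ [] ,
    ≋-trans (solve 2 (λ a b → b := (con false :+ b :* (con true :+ b :* con false)) :+ a :* con false)
                     ≋-refl a b)
            (+-cong (+-cong (≋-sym (const≋cst false)) (≋-refl {b *ₚ evalAt (true ∷ []) b}))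
                    (≋-refl {a *ₚ []}))

F₂[_,_]ʳ : Poly → Poly → RawRing 0ℓ 0ℓ
F₂[ a , b ]ʳ = record
  { Carrier = Σ Poly (_∈F₂[ a , b ])
  ; _≈_     = λ f g → proj₁ f ≋ proj₁ g
  ; _+_     = λ f g → proj₁ f +ₚ proj₁ g , +-∈ (proj₂ f) (proj₂ g)
  ; _*_     = λ f g → proj₁ f *ₚ proj₁ g , *-∈ (proj₂ f) (proj₂ g)
  ; -_      = λ f → f
  ; 0#      = [] , 0-∈
  ; 1#      = 1ₚ , 1-∈
  }

-- Computing in F₂[ a , b ]ʳ carries membership proofs along; forgetting them gives back the
-- computation in F₂[z] definitionally.
module Membership (a b : Poly) where
  open Formulas F₂[z]ʳ a b
  private module Sub = Formulas F₂[ a , b ]ʳ (a , a-∈) (b , b-∈)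

  forget : Sub.Params → Params
  forget t = params (proj₁ (Sub.r t)) (proj₁ (Sub.p t)) (proj₁ (Sub.ρ t))

  forget-δ-cofactor : ∀ t → proj₁ (Sub.δ-cofactor t) ≡ δ-cofactor (forget t)
  forget-δ-cofactor t = refl

  forget-paramsAt : ∀ j → forget (Sub.paramsAt j) ≡ paramsAt j
  forget-paramsAt zero    = refl
  forget-paramsAt (suc j) = cong next (forget-paramsAt j)

  δ-cofactor-∈ : ∀ j → δ-cofactor (paramsAt j) ∈F₂[ a , b ]
  δ-cofactor-∈ j =
    subst (_∈F₂[ a , b ])
          (trans (forget-δ-cofactor (Sub.paramsAt j)) (cong δ-cofactor (forget-paramsAt j)))
          (proj₂ (Sub.δ-cofactor (Sub.paramsAt j)))

proposition4p7 : (a b : Poly) → NonConstant a → NonConstant b → ¬ (a ≈ₚ b) →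
    (k : ℕ) → 1 ≤ k →
    ∃ λ (T : BiPoly) → δ k a b ≈ₚ ((a *ₚ b) ^ₚ (2 * nk k)) *ₚ evalBi T a b
proposition4p7 a b _ _ _ (suc j) (s≤s z≤n) = T , ≋⇒≈ₚ δ≋
  where
  T : BiPoly
  T = proj₁ (Membership.δ-cofactor-∈ a b j)

  δ≋ : δ (suc j) a b ≋ (a *ₚ b) ^ₚ (2 * nk (suc j)) *ₚ evalBi T a b
  δ≋ = ≋-trans (Recursion.δ-factorisation a b j)
    (*-cong (≋-reflexive (cong ((a *ₚ b) ^ₚ_) (ℕ.^-*-assoc 2 2 (suc j))))
            (proj₂ (Membership.δ-cofactor-∈ a b j)))
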